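{- Let $m,n\geq1$, let $K_{m,n}$ be the complete bipartite graph with parts of sizes $m$ and $n$ and adjacency matrix $A_{K_{m,n}}$, let $k\geq1$ and $\tilde{A}_{K_{m,n}}=I_k\otimes A_{K_{m,n}}$. If $P$ is a permutation matrix of size $k(m+n)$ such that $\tilde{A}_{K_{m,n}}P\tilde{A}_{K_{m,n}}$ is symmetric, then there exists a symmetric permutation matrix $Q$ of size $k(m+n)$ such that $\tilde{A}_{K_{m,n}}P\tilde{A}_{K_{m,n}}=\tilde{A}_{K_{m,n}}Q\tilde{A}_{K_{m,n}}$. That is, every permutational $k$-th power of $K_{m,n}$ can be obtained by a classical zig-zag product.
   Context: The permutational $k$-th power of a graph $H$ with respect to a permutation with matrix $P$ is the graph with adjacency matrix $(I_k\otimes A_H)P(I_k\otimes A_H)$, defined when this matrix is symmetric; it is obtained by a classical zig-zag product when the same matrix arises from a symmetric permutation matrix. -}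

module Defs where

open import Data.Nat using (ℕ; zero; suc; _+_; _*_)
open import Data.Fin using (Fin; zero; suc; splitAt; remQuot; _≟_)
open import Data.Fin.Permutation using (Permutation′; _⟨$⟩ʳ_)
open import Data.Sum using (inj₁; inj₂)
open import Data.Product using (_,_; ∃)
open import Relation.Nullary using (yes; no)
open import Relation.Binary.PropositionalEquality using (_≡_)

Matrix : ℕ → Set
Matrix N = Fin N → Fin N → ℕ

Σ : (N : ℕ) → (Fin N → ℕ) → ℕ
Σ zero    f = 0
Σ (suc N) f = f zero + Σ N (λ i → f (suc i))

_⊛_ : {N : ℕ} → Matrix N → Matrix N → Matrix N
_⊛_ {N} A B i j = Σ N (λ l → A i l * B l j)
infixl 7 _⊛_

δ : {N : ℕ} → Fin N → Fin N → ℕ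
δ i j with i ≟ j
... | yes _ = 1
... | no  _ = 0

identity : (N : ℕ) → Matrix N
identity N = δ

-- Kronecker product; index of (i , a) is i * s + a (standard ordering)
_⊗_ : {r s : ℕ} → Matrix r → Matrix s → Matrix (r * s)
_⊗_ {r} {s} A B x y with remQuot s x | remQuot s y
... | (i , a) | (j , b) = A i j * B a b

-- adjacency matrix of K_{m,n}: vertices 0..m-1 form one part, m..m+n-1 the other
adjK : (m n : ℕ) → Matrix (m + n)
adjK m n x y with splitAt m x | splitAt m y
... | inj₁ _ | inj₁ _ = 0
... | inj₁ _ | inj₂ _ = 1
... | inj₂ _ | inj₁ _ = 1
... | inj₂ _ | inj₂ _ = 0

Symmetric : {N : ℕ} → Matrix N → Set
Symmetric M = ∀ i j → M i j ≡ M j i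

IsPermutationMatrix : {N : ℕ} → Matrix N → Set
IsPermutationMatrix {N} P = ∃ λ (π : Permutation′ N) → ∀ i j → P i j ≡ δ (π ⟨$⟩ʳ i) j

-- Write Ã = I_k ⊗ A_{K_{m,n}}.  A vertex x of the k copies of K_{m,n} has a
-- class (copy index, side), and Ã x y = 1 exactly when class y is the
-- opposite class of class x (same copy, other side).  For a permutation π
-- with matrix P we have (Ã P Ã) x y = Σ_l Ã x (π⁻¹ l) · Ã l y, so this entry
-- counts the l whose profile (class (π⁻¹ l) , class l) equals
-- (opp (class x) , opp (class y)).  Since every class occurs (m, n ≥ 1),
-- symmetry of Ã P Ã says precisely that the profile values (u , v) and
-- (v , u) occur equally often.  Matching the elements of these two fibres
-- by rank yields an involution σ that swaps profiles; its matrix Q is a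
-- symmetric permutation matrix with the same profile counts as P, hence
-- Ã Q Ã = Ã P Ã.
module Submission where

open import Defs
open import Data.Nat using (ℕ; zero; suc; _+_; _*_; _≤_; _<_; z≤n; s≤s)
open import Data.Nat.Properties
  using (*-zeroʳ; *-identityʳ; +-identityʳ; +-monoʳ-<; +-cancelˡ-≡; 0≢1+n)
open import Data.Bool using (Bool; true; false; not; if_then_else_)
import Data.Bool.Properties as Bool
open import Data.Fin using (Fin; zero; suc; splitAt; remQuot; combine; _↑ˡ_; _↑ʳ_)
open import Data.Fin.Properties using (_≟_; remQuot-combine; splitAt-↑ˡ; splitAt-↑ʳ)
open import Data.Fin.Permutation
  using (Permutation′; _⟨$⟩ʳ_; _⟨$⟩ˡ_; permutation; inverseˡ; inverseʳ)
open import Data.Sum using (_⊎_; inj₁; inj₂)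
open import Data.Product using (Σ-syntax; ∃; _×_; _,_; proj₁; proj₂; swap)
open import Data.Product.Properties using (≡-dec; ×-≡,≡→≡; ×-≡,≡←≡)
open import Data.Empty using (⊥-elim)
open import Function.Bundles using (_⇔_; mk⇔)
open import Relation.Nullary using (Dec; _because_; yes; no; does; _×-dec_; ¬_)
open import Relation.Nullary.Decidable using (does-⇔; dec-true; dec-false)
open import Level using (0ℓ)
open import Relation.Unary using (Pred; Decidable)
open import Relation.Binary.Definitions using (DecidableEquality)
open import Relation.Binary.PropositionalEquality
open ≡-Reasoning

⟦_⟧ : {P : Set} → Dec P → ℕ
⟦ d ⟧ = if does d then 1 else 0

⟦⟧-⇔ : {P Q : Set} → P ⇔ Q → (p : Dec P) (q : Dec Q) → ⟦ p ⟧ ≡ ⟦ q ⟧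
⟦⟧-⇔ P⇔Q p q = cong (λ b → if b then 1 else 0) (does-⇔ P⇔Q p q)

⟦⟧-yes : {P : Set} → P → (p : Dec P) → ⟦ p ⟧ ≡ 1
⟦⟧-yes x p = cong (λ b → if b then 1 else 0) (dec-true p x)

⟦⟧-no : {P : Set} → ¬ P → (p : Dec P) → ⟦ p ⟧ ≡ 0
⟦⟧-no ¬x p = cong (λ b → if b then 1 else 0) (dec-false p ¬x)

⟦⟧-× : {P Q : Set} (p : Dec P) (q : Dec Q) → ⟦ p ⟧ * ⟦ q ⟧ ≡ ⟦ p ×-dec q ⟧
⟦⟧-× (true because _)  (true because _)  = refl
⟦⟧-× (true because _)  (false because _) = refl
⟦⟧-× (false because _) _                 = refl

⟦⟧-pair : {A B : Set} (_≟A_ : DecidableEquality A) (_≟B_ : DecidableEquality B)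
  (a c : A) (b d : B) →
  ⟦ a ≟A c ⟧ * ⟦ b ≟B d ⟧ ≡ ⟦ ≡-dec _≟A_ _≟B_ (a , b) (c , d) ⟧
⟦⟧-pair _≟A_ _≟B_ a c b d =
  trans (⟦⟧-× (a ≟A c) (b ≟B d)) (⟦⟧-⇔ (mk⇔ ×-≡,≡→≡ ×-≡,≡←≡)
    ((a ≟A c) ×-dec (b ≟B d)) (≡-dec _≟A_ _≟B_ (a , b) (c , d)))

Σ-cong : ∀ N {f g : Fin N → ℕ} → (∀ i → f i ≡ g i) → Σ N f ≡ Σ N g
Σ-cong zero    f≡g = refl
Σ-cong (suc N) f≡g = cong₂ _+_ (f≡g zero) (Σ-cong N (λ i → f≡g (suc i)))

Σ-zero : ∀ N {f : Fin N → ℕ} → (∀ i → f i ≡ 0) → Σ N f ≡ 0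
Σ-zero N f≡0 = trans (Σ-cong N f≡0) (Σ0 N)
  where
  Σ0 : ∀ N → Σ N (λ _ → 0) ≡ 0
  Σ0 zero    = refl
  Σ0 (suc N) = Σ0 N

δ-indicator : ∀ {N} (i j : Fin N) → δ i j ≡ ⟦ i ≟ j ⟧
δ-indicator i j with i ≟ j
... | yes _ = refl
... | no  _ = refl

δ-sym : ∀ {N} (i j : Fin N) → δ i j ≡ δ j i
δ-sym i j = begin
  δ i j      ≡⟨ δ-indicator i j ⟩
  ⟦ i ≟ j ⟧  ≡⟨ ⟦⟧-⇔ (mk⇔ sym sym) (i ≟ j) (j ≟ i) ⟩
  ⟦ j ≟ i ⟧  ≡⟨ δ-indicator j i ⟨
  δ j i      ∎

δ-suc : ∀ {N} (i j : Fin N) → δ (suc i) (suc j) ≡ δ i j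
δ-suc i j = trans (δ-indicator (suc i) (suc j)) (sym (δ-indicator i j))

Σ-δ : ∀ N (h : Fin N → ℕ) (t : Fin N) → Σ N (λ l → h l * δ l t) ≡ h t
Σ-δ (suc N) h zero = begin
  h zero * 1 + Σ N (λ l → h (suc l) * 0)  ≡⟨ cong₂ _+_ (*-identityʳ (h zero))
                                              (Σ-zero N (λ l → *-zeroʳ (h (suc l)))) ⟩
  h zero + 0                              ≡⟨ +-identityʳ (h zero) ⟩
  h zero                                  ∎
Σ-δ (suc N) h (suc t) = begin
  h zero * 0 + Σ N (λ l → h (suc l) * δ (suc l) (suc t))
    ≡⟨ cong₂ _+_ (*-zeroʳ (h zero)) (Σ-cong N (λ l → cong (h (suc l) *_) (δ-suc l t))) ⟩
  Σ N (λ l → h (suc l) * δ l t)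
    ≡⟨ Σ-δ N (λ l → h (suc l)) t ⟩
  h (suc t) ∎

δ-transpose : ∀ {N} (π : Permutation′ N) (a b : Fin N) →
  δ (π ⟨$⟩ʳ a) b ≡ δ a (π ⟨$⟩ˡ b)
δ-transpose π a b = begin
  δ (π ⟨$⟩ʳ a) b          ≡⟨ δ-indicator (π ⟨$⟩ʳ a) b ⟩
  ⟦ π ⟨$⟩ʳ a ≟ b ⟧        ≡⟨ ⟦⟧-⇔ (mk⇔ to from) (π ⟨$⟩ʳ a ≟ b) (a ≟ π ⟨$⟩ˡ b) ⟩
  ⟦ a ≟ π ⟨$⟩ˡ b ⟧        ≡⟨ δ-indicator a (π ⟨$⟩ˡ b) ⟨
  δ a (π ⟨$⟩ˡ b)          ∎
  where
  to : π ⟨$⟩ʳ a ≡ b → a ≡ π ⟨$⟩ˡ b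
  to e = trans (sym (inverseˡ π)) (cong (π ⟨$⟩ˡ_) e)
  from : a ≡ π ⟨$⟩ˡ b → π ⟨$⟩ʳ a ≡ b
  from e = trans (cong (π ⟨$⟩ʳ_) e) (inverseʳ π)

sandwich : ∀ {N} (A B R : Matrix N) (π : Permutation′ N) →
  (∀ i j → R i j ≡ δ (π ⟨$⟩ʳ i) j) →
  ∀ x y → (A ⊛ R ⊛ B) x y ≡ Σ N (λ l → A x (π ⟨$⟩ˡ l) * B l y)
sandwich {N} A B R π R≡π x y = Σ-cong N (λ l → cong (_* B l y) (column l))
  where
  column : ∀ l → (A ⊛ R) x l ≡ A x (π ⟨$⟩ˡ l)
  column l = begin
    Σ N (λ l′ → A x l′ * R l′ l)            ≡⟨ Σ-cong N (λ l′ → cong (A x l′ *_)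
                                                 (trans (R≡π l′ l) (δ-transpose π l′ l))) ⟩
    Σ N (λ l′ → A x l′ * δ l′ (π ⟨$⟩ˡ l))  ≡⟨ Σ-δ N (A x) (π ⟨$⟩ˡ l) ⟩
    A x (π ⟨$⟩ˡ l)                          ∎

count : ∀ {N} {P : Pred (Fin N) 0ℓ} → Decidable P → ℕ
count {N} P? = Σ N (λ y → ⟦ P? y ⟧)

rank : ∀ {N} {P : Pred (Fin N) 0ℓ} → Decidable P → Fin N → ℕ
rank P? zero    = 0
rank P? (suc x) = ⟦ P? zero ⟧ + rank (λ y → P? (suc y)) x

rank<count : ∀ {N} {P : Pred (Fin N) 0ℓ} (P? : Decidable P) {x} → P x → rank P? x < count P?
rank<count P? {zero} Px rewrite ⟦⟧-yes Px (P? zero) = s≤s z≤n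
rank<count P? {suc x} Px = +-monoʳ-< ⟦ P? zero ⟧ (rank<count (λ y → P? (suc y)) Px)

select : ∀ {N} {P : Pred (Fin N) 0ℓ} (P? : Decidable P) r → r < count P? →
  Σ[ y ∈ Fin N ] (P y × rank P? y ≡ r)
select {suc N} P? r r<count with P? zero
select {suc N} P? zero    _             | yes P0 = zero , P0 , refl
select {suc N} P? (suc r) (s≤s r<count) | yes P0 with select (λ y → P? (suc y)) r r<count
... | y , Py , rank≡r =
  suc y , Py , cong₂ _+_ (⟦⟧-yes P0 (P? zero)) rank≡r
select {suc N} P? r r<count | no ¬P0 with select (λ y → P? (suc y)) r r<count
... | y , Py , rank≡r =
  suc y , Py , trans (cong (_+ rank (λ z → P? (suc z)) y) (⟦⟧-no ¬P0 (P? zero))) rank≡r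

rank-injective : ∀ {N} {P : Pred (Fin N) 0ℓ} (P? : Decidable P) {y z} →
  P y → P z → rank P? y ≡ rank P? z → y ≡ z
rank-injective P? {zero}  {zero}  _  _  _ = refl
rank-injective P? {zero}  {suc z} Py _  e = ⊥-elim (0≢1+n (trans e
  (cong (_+ rank (λ x → P? (suc x)) z) (⟦⟧-yes Py (P? zero)))))
rank-injective P? {suc y} {zero}  _  Pz e = ⊥-elim (0≢1+n (trans (sym e)
  (cong (_+ rank (λ x → P? (suc x)) y) (⟦⟧-yes Pz (P? zero)))))
rank-injective P? {suc y} {suc z} Py Pz e =
  cong suc (rank-injective (λ x → P? (suc x)) Py Pz (+-cancelˡ-≡ ⟦ P? zero ⟧ _ _ e))

fiberSize : ∀ {N} {K : Set} → DecidableEquality K → (Fin N → K) → K → ℕ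
fiberSize _≟K_ key κ = count (λ y → key y ≟K κ)

fiberSize-cong : ∀ {N} {K : Set} (_≟K_ : DecidableEquality K) {key key′ : Fin N → K} →
  (∀ l → key l ≡ key′ l) → ∀ κ → fiberSize _≟K_ key κ ≡ fiberSize _≟K_ key′ κ
fiberSize-cong {N} _≟K_ key≡key′ κ = Σ-cong N (λ l → cong (λ z → ⟦ z ≟K κ ⟧) (key≡key′ l))

record Matching {N} {K : Set} (key : Fin N → K) (swp : K → K) : Set where
  field
    σ          : Fin N → Fin N
    involutive : ∀ x → σ (σ x) ≡ x
    transports : ∀ x → key (σ x) ≡ swp (key x)

-- If the fibres of κ and swp κ always have equal sizes, pairing the i-th
-- element of one fibre with the i-th element of the other gives a matching.
fiberMatching : ∀ {N} {K : Set} (_≟K_ : DecidableEquality K) (key : Fin N → K)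
  (swp : K → K) → (∀ κ → swp (swp κ) ≡ κ) →
  (∀ κ → fiberSize _≟K_ key κ ≡ fiberSize _≟K_ key (swp κ)) → Matching key swp
fiberMatching {N} _≟K_ key swp swp-involutive balanced =
  record { σ = σ ; involutive = involutive ; transports = transports }
  where
  fiber : ∀ κ → Decidable (λ y → key y ≡ κ)
  fiber κ y = key y ≟K κ

  pos : Fin N → ℕ
  pos x = rank (fiber (key x)) x

  partner : ∀ x → Σ[ y ∈ Fin N ] (key y ≡ swp (key x) × rank (fiber (swp (key x))) y ≡ pos x)
  partner x = select (fiber (swp (key x))) (pos x)
    (subst (pos x <_) (balanced (key x)) (rank<count (fiber (key x)) refl))

  σ : Fin N → Fin N
  σ x = partner x .proj₁

  transports : ∀ x → key (σ x) ≡ swp (key x)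
  transports x = partner x .proj₂ .proj₁

  keeps-rank : ∀ x → rank (fiber (swp (key x))) (σ x) ≡ pos x
  keeps-rank x = partner x .proj₂ .proj₂

  key-σσ : ∀ x → swp (key (σ x)) ≡ key x
  key-σσ x = trans (cong swp (transports x)) (swp-involutive (key x))

  involutive : ∀ x → σ (σ x) ≡ x
  involutive x = rank-injective (fiber (key x))
    (trans (transports (σ x)) (key-σσ x)) refl (begin
      rank (fiber (key x)) (σ (σ x))            ≡⟨ cong (λ κ → rank (fiber κ) (σ (σ x))) (key-σσ x) ⟨
      rank (fiber (swp (key (σ x)))) (σ (σ x))  ≡⟨ keeps-rank (σ x) ⟩
      rank (fiber (key (σ x))) (σ x)            ≡⟨ cong (λ κ → rank (fiber κ) (σ x)) (transports x) ⟩
      rank (fiber (swp (key x))) (σ x)          ≡⟨ keeps-rank x ⟩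
      rank (fiber (key x)) x                    ∎)

-- A vertex class of k disjoint copies of K_{m,n}: copy index and side
-- (true for the part of size m).
Class : ℕ → Set
Class k = Fin k × Bool

_≟ᶜ_ : ∀ {k} → DecidableEquality (Class k)
_≟ᶜ_ = ≡-dec _≟_ Bool._≟_

opp : ∀ {k} → Class k → Class k
opp (i , s) = i , not s

opp-involutive : ∀ {k} (c : Class k) → opp (opp c) ≡ c
opp-involutive (i , s) = cong (i ,_) (Bool.not-involutive s)

link : ∀ {k} → Class k → Class k → ℕ
link c e = ⟦ e ≟ᶜ opp c ⟧

link-sym : ∀ {k} (c e : Class k) → link c e ≡ link e c
link-sym c e = ⟦⟧-⇔ (mk⇔ (opp-swap c e) (opp-swap e c)) (e ≟ᶜ opp c) (c ≟ᶜ opp e)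
  where
  opp-swap : ∀ c e → e ≡ opp c → c ≡ opp e
  opp-swap c e e≡opp = trans (sym (opp-involutive c)) (cong opp (sym e≡opp))

module CompleteBipartite (m n k : ℕ) where

  side : Fin m ⊎ Fin n → Bool
  side (inj₁ _) = true
  side (inj₂ _) = false

  classOf : Fin k × Fin (m + n) → Class k
  classOf (i , a) = i , side (splitAt m a)

  class : Fin (k * (m + n)) → Class k
  class x = classOf (remQuot (m + n) x)

  Ã : Matrix (k * (m + n))
  Ã = identity k ⊗ adjK m n

  adjK-side : ∀ a b → adjK m n a b ≡ ⟦ side (splitAt m b) Bool.≟ not (side (splitAt m a)) ⟧
  adjK-side a b with splitAt m a | splitAt m b
  ... | inj₁ _ | inj₁ _ = refl
  ... | inj₁ _ | inj₂ _ = refl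
  ... | inj₂ _ | inj₁ _ = refl
  ... | inj₂ _ | inj₂ _ = refl

  Ã-link : ∀ x y → Ã x y ≡ link (class x) (class y)
  Ã-link x y = linkOf (remQuot (m + n) x) (remQuot (m + n) y)
    where
    linkOf : ∀ ((i , a) (j , b) : Fin k × Fin (m + n)) →
      δ i j * adjK m n a b ≡ link (classOf (i , a)) (classOf (j , b))
    linkOf (i , a) (j , b) = begin
      δ i j * adjK m n a b
        ≡⟨ cong₂ _*_ (trans (δ-sym i j) (δ-indicator j i)) (adjK-side a b) ⟩
      ⟦ j ≟ i ⟧ * ⟦ side (splitAt m b) Bool.≟ not (side (splitAt m a)) ⟧
        ≡⟨ ⟦⟧-pair _≟_ Bool._≟_ j i (side (splitAt m b)) (not (side (splitAt m a))) ⟩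
      link (classOf (i , a)) (classOf (j , b)) ∎

  class-surjective : 1 ≤ m → 1 ≤ n → ∀ c → ∃ λ x → class x ≡ c
  class-surjective (s≤s _) _ (i , true) = combine i (zero ↑ˡ n) ,
    trans (cong classOf (remQuot-combine i (zero ↑ˡ n))) (cong (λ z → i , side z) (splitAt-↑ˡ m zero n))
  class-surjective _ (s≤s _) (i , false) = combine i (m ↑ʳ zero) ,
    trans (cong classOf (remQuot-combine i (m ↑ʳ zero))) (cong (λ z → i , side z) (splitAt-↑ʳ m n zero))

  opp-class-surjective : 1 ≤ m → 1 ≤ n → ∀ c → ∃ λ x → opp (class x) ≡ c
  opp-class-surjective 1≤m 1≤n c with class-surjective 1≤m 1≤n (opp c)
  ... | x , class≡opp = x , trans (cong opp class≡opp) (opp-involutive c)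

  _≟ᵖ_ : DecidableEquality (Class k × Class k)
  _≟ᵖ_ = ≡-dec _≟ᶜ_ _≟ᶜ_

  profile : Permutation′ (k * (m + n)) → Fin (k * (m + n)) → Class k × Class k
  profile π l = class (π ⟨$⟩ˡ l) , class l

  entry : (P : Matrix (k * (m + n))) (π : Permutation′ (k * (m + n))) →
    (∀ i j → P i j ≡ δ (π ⟨$⟩ʳ i) j) →
    ∀ x y → (Ã ⊛ P ⊛ Ã) x y ≡ fiberSize _≟ᵖ_ (profile π) (opp (class x) , opp (class y))
  entry P π P≡π x y = trans (sandwich Ã Ã P π P≡π x y) (Σ-cong _ λ l → begin
    Ã x (π ⟨$⟩ˡ l) * Ã l y
      ≡⟨ cong₂ _*_ (Ã-link x (π ⟨$⟩ˡ l)) (trans (Ã-link l y) (link-sym (class l) (class y))) ⟩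
    link (class x) (class (π ⟨$⟩ˡ l)) * link (class y) (class l)
      ≡⟨ ⟦⟧-pair _≟ᶜ_ _≟ᶜ_ (class (π ⟨$⟩ˡ l)) (opp (class x)) (class l) (opp (class y)) ⟩
    ⟦ profile π l ≟ᵖ (opp (class x) , opp (class y)) ⟧ ∎)

  balanced : 1 ≤ m → 1 ≤ n → (P : Matrix (k * (m + n))) (π : Permutation′ (k * (m + n))) →
    (∀ i j → P i j ≡ δ (π ⟨$⟩ʳ i) j) → Symmetric (Ã ⊛ P ⊛ Ã) →
    ∀ κ → fiberSize _≟ᵖ_ (profile π) κ ≡ fiberSize _≟ᵖ_ (profile π) (swap κ)
  balanced 1≤m 1≤n P π P≡π symmetric (u , v)
    with opp-class-surjective 1≤m 1≤n u | opp-class-surjective 1≤m 1≤n v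
  ... | x , refl | y , refl =
    trans (sym (entry P π P≡π x y)) (trans (symmetric x y) (entry P π P≡π y x))

theorem4p14 : (m n k : ℕ) → 1 ≤ m → 1 ≤ n → 1 ≤ k →
    (P : Matrix (k * (m + n))) → IsPermutationMatrix P →
    Symmetric ((identity k ⊗ adjK m n) ⊛ P ⊛ (identity k ⊗ adjK m n)) →
    Σ[ Q ∈ Matrix (k * (m + n)) ] (IsPermutationMatrix Q × Symmetric Q ×
      (∀ i j → ((identity k ⊗ adjK m n) ⊛ P ⊛ (identity k ⊗ adjK m n)) i j
             ≡ ((identity k ⊗ adjK m n) ⊛ Q ⊛ (identity k ⊗ adjK m n)) i j))
theorem4p14 m n k 1≤m 1≤n _ P (π , P≡π) symmetric =
  Q , (ρ , λ _ _ → refl) , Q-symmetric , same-product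
  where
  open CompleteBipartite m n k
  open Matching (fiberMatching _≟ᵖ_ (profile π) swap (λ _ → refl)
                                (balanced 1≤m 1≤n P π P≡π symmetric))

  ρ : Permutation′ (k * (m + n))
  ρ = permutation σ σ involutive involutive

  Q : Matrix (k * (m + n))
  Q i j = δ (σ i) j

  Q-symmetric : Symmetric Q
  Q-symmetric i j = trans (δ-transpose ρ i j) (δ-sym i (σ j))

  -- σ swaps profiles, so ρ has the same profile as π.
  same-profile : ∀ l → profile ρ l ≡ profile π l
  same-profile l = cong (_, class l) (cong proj₂ (transports l))

  same-product : ∀ x y → (Ã ⊛ P ⊛ Ã) x y ≡ (Ã ⊛ Q ⊛ Ã) x y
  same-product x y = begin
    (Ã ⊛ P ⊛ Ã) x y                                            ≡⟨ entry P π P≡π x y ⟩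
    fiberSize _≟ᵖ_ (profile π) (opp (class x) , opp (class y))  ≡⟨ fiberSize-cong _≟ᵖ_ same-profile _ ⟨
    fiberSize _≟ᵖ_ (profile ρ) (opp (class x) , opp (class y))  ≡⟨ entry Q ρ (λ _ _ → refl) x y ⟨
    (Ã ⊛ Q ⊛ Ã) x y                                            ∎
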